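{- Let $G$ be a graph with win partition $\alpha=\{\alpha_1,\dots,\alpha_k\}$ and let $w,w'\in\alpha_i$ for some $i$. Let $C_0$ be a configuration of $G$, let $C_1,C_2,\dots$ be the configurations produced by the $w$-power index process with initial configuration $C_0$, and let $C'_1,C'_2,\dots$ be those produced by the $w'$-power index process with initial configuration $C'_0=C_0$. Then $C'_t=C_t$ for all $t>0$.
   Context: All graphs are finite and simple. A configuration of a graph $G$ is a map $C:V(G)\to\{C,D\}$; vertices with value $C$ are collaborators, those with value $D$ defectors. $N[v]$ is the closed neighbourhood of $v$, $N_C[v]$ is the set of collaborators in $N[v]$ and $N_D[v]$ the set of defectors in $N[v]$. For a win condition $w\in\left[\frac12,1\right)$, the power of $v$ with respect to a configuration is: if $v$ is a collaborator, $p(v)=1/|N_C[v]|$ when $|N_C[v]|/|N[v]|>w$ and $p(v)=0$ otherwise; if $v$ is a defector, $p(v)=1/|N_D[v]|$ when $|N_C[v]|/|N[v]|\le w$ and $p(v)=0$ otherwise. The $w$-power index process with initial configuration $C_0$ produces configurations $C_1,C_2,\dots$: for $t\ge1$ each vertex $v$ simultaneously takes the strategy that, in $C_{t-1}$, is held by the vertex of $N[v]$ of greatest power (powers computed with respect to $C_{t-1}$); if the vertices of $N[v]$ of greatest power have differing strategies, then $C_t(v)=C_{t-1}(v)$. Win partition: for $v\in V(G)$ let $S_v=\{i/|N[v]| : i\in\mathbb Z,\ |N[v]|/2\le i\le |N[v]|\}$ and $S_G=\bigcup_{v\in V(G)}S_v$. Writing $S_G=\{s_1<s_2<\dots<s_{|S_G|}\}$,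 the win partition of $G$ is $\{[\tfrac12,s_1),[s_1,s_2),\dots,[s_{|S_G|-1},s_{|S_G|})\}$, a partition of $[\tfrac12,1)$. -}

module Defs where

open import Data.Bool using (Bool; true; false; if_then_else_; not; _∨_; _∧_)
open import Data.Nat as ℕ using (ℕ; zero; suc)
open import Data.Integer using (+_)
open import Data.Fin using (Fin)
open import Data.Fin.Properties using () renaming (_≟_ to _≟ᶠ_)
open import Data.List using (List; length; filterᵇ; allFin; map; foldr)
open import Data.Rational using (ℚ; 0ℚ; ½; _/_; _≤ᵇ_; _⊔_; _≤_; _<_)
open import Data.Rational.Properties using (_≟_)
open import Data.Product using (Σ; _×_)
open import Data.Sum using (_⊎_)
open import Relation.Nullary using (does)
open import Relation.Binary.PropositionalEquality using (_≡_)

record Graph (n : ℕ) : Set where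
  field
    adj        : Fin n → Fin n → Bool
    adj-sym    : ∀ u v → adj u v ≡ adj v u
    adj-irrefl : ∀ v → adj v v ≡ false
open Graph public

data Strategy : Set where
  C D : Strategy

isC : Strategy → Bool
isC C = true
isC D = false

isD : Strategy → Bool
isD s = not (isC s)

allᵇ : {A : Set} → (A → Bool) → List A → Bool
allᵇ p = foldr (λ x b → p x ∧ b) true

Config : ℕ → Set
Config n = Fin n → Strategy

-- a / d as a rational; the case d = 0 never arises where it is used
frac : ℕ → ℕ → ℚ
frac a zero    = 0ℚ
frac a (suc d) = (+ a) / suc d

module _ {n : ℕ} (G : Graph n) where

  N[_] : Fin n → List (Fin n)
  N[ v ] = filterᵇ (λ u → does (u ≟ᶠ v) ∨ adj G v u) (allFin n)

  deg[_] : Fin n → ℕ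
  deg[ v ] = length N[ v ]

  nC : Config n → Fin n → ℕ
  nC c v = length (filterᵇ (λ u → isC (c u)) N[ v ])

  nD : Config n → Fin n → ℕ
  nD c v = length (filterᵇ (λ u → isD (c u)) N[ v ])

  power : ℚ → Config n → Fin n → ℚ
  power w c v with c v
  ... | C = if frac (nC c v) deg[ v ] ≤ᵇ w then 0ℚ else frac 1 (nC c v)
  ... | D = if frac (nC c v) deg[ v ] ≤ᵇ w then frac 1 (nD c v) else 0ℚ

  step : ℚ → Config n → Config n
  step w c v =
    let ps      = map (power w c) N[ v ]
        M       = foldr _⊔_ 0ℚ ps
        winners = filterᵇ (λ u → does (power w c u ≟ M)) N[ v ]
    in if allᵇ (λ u → isC (c u)) winners then C
       else if allᵇ (λ u → isD (c u)) winners then D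
       else c v

  run : ℚ → Config n → ℕ → Config n
  run w c zero    = c
  run w c (suc t) = step w (run w c t)

  InS : ℚ → Set
  InS s = Σ (Fin n) λ v → Σ ℕ λ i →
            (deg[ v ] ℕ.≤ 2 ℕ.* i) × (i ℕ.≤ deg[ v ]) × (s ≡ frac i deg[ v ])

  -- [lo, hi) is a part of the win partition of G:
  -- either [1/2, s₁) with s₁ = min S_G, or [s_j, s_{j+1}) for consecutive elements of S_G
  IsWinPart : ℚ → ℚ → Set
  IsWinPart lo hi =
      (lo ≡ ½ × InS hi × (∀ s → InS s → hi ≤ s))
    ⊎ (InS lo × InS hi × lo < hi × (∀ s → InS s → s ≤ lo ⊎ hi ≤ s))

  SameWinPart : ℚ → ℚ → Set
  SameWinPart w w' = Σ ℚ λ lo → Σ ℚ λ hi →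
    IsWinPart lo hi × (lo ≤ w × w < hi) × (lo ≤ w' × w' < hi)

module Submission where

-- The w-power index process depends on w only through the threshold tests
-- "|N_C[v]| / |N[v]| ≤ w" made while computing powers.  Each tested ratio
-- a/d (a ≤ d = |N[v]|) is either at most ½ or, when d ≤ 2a, an element of
-- S_G.  A part [lo, hi) of the win partition satisfies ½ ≤ lo and contains
-- no element of S_G, so every tested ratio lies below lo or at/above hi, and
-- the test has the same outcome for every w in [lo, hi).
--
-- Abstracting a step over its power function, a
-- step is a congruence in powers and configuration; induction on t then
-- gives the theorem.

open import Defs
open import Data.Nat using (ℕ; _<_)
open import Data.Fin using (Fin)
open import Data.Rational using (ℚ)
open import Relation.Binary.PropositionalEquality using (_≡_)

open import Data.Bool using (Bool; true; false; T; _∧_; _∨_; if_then_else_)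
open import Data.Bool.Properties using (T?; T-≡; ¬-not)
open import Function.Bundles using (Equivalence)
open import Data.Unit using (tt)
open import Data.Empty using (⊥-elim)
open import Data.Product using (_,_)
open import Data.Sum using (_⊎_; inj₁; inj₂)
open import Data.List using (List; []; _∷_; length; filterᵇ; map; foldr)
open import Data.List.Properties using (map-cong; filter-≐; length-filter; filter-some)
import Data.List.Relation.Unary.Any as Any
open import Data.List.Membership.Propositional.Properties using (∈-allFin)
open import Data.Fin.Properties using () renaming (_≟_ to _≟ᶠ_)
open import Function using (_∘_)
open import Relation.Nullary using (yes; no; does)
open import Relation.Binary.PropositionalEquality
  using (refl; cong; cong₂; sym; trans; subst; subst₂; _≗_; module ≡-Reasoning)
import Data.Nat as ℕ
import Data.Nat.Properties as ℕP
import Data.Integer as ℤ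
import Data.Integer.Properties as ℤP
import Data.Rational as ℚ
import Data.Rational.Properties as ℚP
import Data.Rational.Unnormalised as ℚᵘ
import Data.Rational.Unnormalised.Properties as ℚᵘP

filterᵇ-cong : {A : Set} {p q : A → Bool} → p ≗ q → filterᵇ p ≗ filterᵇ q
filterᵇ-cong {p = p} {q} p≗q =
  filter-≐ (T? ∘ p) (T? ∘ q) ((λ {x} → subst T (p≗q x)) , (λ {x} → subst T (sym (p≗q x))))

allᵇ-cong : {A : Set} {p q : A → Bool} → p ≗ q → allᵇ p ≗ allᵇ q
allᵇ-cong p≗q []       = refl
allᵇ-cong p≗q (x ∷ xs) = cong₂ _∧_ (p≗q x) (allᵇ-cong p≗q xs)

frac-≤ : ∀ a b d d' → a ℕ.* ℕ.suc d' ℕ.≤ b ℕ.* ℕ.suc d →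
         frac a (ℕ.suc d) ℚ.≤ frac b (ℕ.suc d')
frac-≤ a b d d' cross =
  ℚP.toℚᵘ-cancel-≤ (ℚᵘP.≤-respˡ-≃ (ℚᵘP.≃-sym (toℚᵘ-frac a d))
                     (ℚᵘP.≤-respʳ-≃ (ℚᵘP.≃-sym (toℚᵘ-frac b d'))
                       (ℚᵘ.*≤* (subst₂ ℤ._≤_ (ℤP.pos-* a (ℕ.suc d')) (ℤP.pos-* b (ℕ.suc d))
                                 (ℤ.+≤+ cross)))))
  where
  toℚᵘ-frac : ∀ i d → ℚ.toℚᵘ (frac i (ℕ.suc d)) ℚᵘ.≃ ℚᵘ.mkℚᵘ (ℤ.+ i) d
  toℚᵘ-frac i d = ℚP.toℚᵘ-fromℚᵘ (ℚᵘ.mkℚᵘ (ℤ.+ i) d)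

½-≤-frac : ∀ i d → ℕ.suc d ℕ.≤ 2 ℕ.* i → ℚ.½ ℚ.≤ frac i (ℕ.suc d)
½-≤-frac i d d<2i = frac-≤ 1 i 1 d (subst₂ ℕ._≤_ (sym (ℕP.*-identityˡ _)) (ℕP.*-comm 2 i) d<2i)

frac-≤-½ : ∀ i d → 2 ℕ.* i ℕ.≤ d → frac i d ℚ.≤ ℚ.½
frac-≤-½ i ℕ.zero    _     = ℚP.≤ᵇ⇒≤ tt
frac-≤-½ i (ℕ.suc d) 2i≤d = frac-≤ i 1 d 1 (subst₂ ℕ._≤_ (ℕP.*-comm 2 i) (sym (ℕP.*-identityˡ _)) 2i≤d)

≤ᵇ-outside : ∀ {s lo hi w w'} → s ℚ.≤ lo ⊎ hi ℚ.≤ s →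
             lo ℚ.≤ w → w ℚ.< hi → lo ℚ.≤ w' → w' ℚ.< hi →
             (s ℚ.≤ᵇ w) ≡ (s ℚ.≤ᵇ w')
≤ᵇ-outside (inj₁ s≤lo) lo≤w _ lo≤w' _ =
  trans (accepts (ℚP.≤-trans s≤lo lo≤w)) (sym (accepts (ℚP.≤-trans s≤lo lo≤w')))
  where
  accepts : ∀ {s x} → s ℚ.≤ x → (s ℚ.≤ᵇ x) ≡ true
  accepts = Equivalence.to T-≡ ∘ ℚP.≤⇒≤ᵇ
≤ᵇ-outside (inj₂ hi≤s) _ w<hi _ w'<hi =
  trans (rejects (ℚP.<-≤-trans w<hi hi≤s)) (sym (rejects (ℚP.<-≤-trans w'<hi hi≤s)))
  where
  rejects : ∀ {s x} → x ℚ.< s → (s ℚ.≤ᵇ x) ≡ false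
  rejects x<s = ¬-not λ s≤ᵇx →
    ℚP.<-irrefl refl (ℚP.<-≤-trans x<s (ℚP.≤ᵇ⇒≤ (Equivalence.from T-≡ s≤ᵇx)))

module _ {n : ℕ} (G : Graph n) where

  -- Every closed neighbourhood contains its centre, so degrees are positive.
  deg-pos : ∀ v → 0 < deg[_] G v
  deg-pos v = filter-some (T? ∘ inN) (Any.map centre (∈-allFin v))
    where
    inN : Fin n → Bool
    inN u = does (u ≟ᶠ v) ∨ adj G v u
    centre : ∀ {u} → v ≡ u → T (inN u)
    centre refl with v ≟ᶠ v
    ... | yes _ = tt
    ... | no v≢v = ⊥-elim (v≢v refl)

  InS-½ : ∀ {s} → InS G s → ℚ.½ ℚ.≤ s
  InS-½ (v , i , d≤2i , _ , refl) with deg[_] G v | deg-pos v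
  ... | ℕ.suc d | _ = ½-≤-frac i d d≤2i

  winPart-½ : ∀ {lo hi} → IsWinPart G lo hi → ℚ.½ ℚ.≤ lo
  winPart-½ (inj₁ (refl , _))  = ℚP.≤-refl
  winPart-½ (inj₂ (InS-lo , _)) = InS-½ InS-lo

  winPart-avoids : ∀ {lo hi s} → IsWinPart G lo hi → InS G s → s ℚ.≤ lo ⊎ hi ℚ.≤ s
  winPart-avoids (inj₁ (_ , _ , hi-min))   InS-s = inj₂ (hi-min _ InS-s)
  winPart-avoids (inj₂ (_ , _ , _ , apart)) InS-s = apart _ InS-s

  ratio : Config n → Fin n → ℚ
  ratio c v = frac (nC G c v) (deg[_] G v)

  ratio-critical : ∀ c v → ratio c v ℚ.≤ ℚ.½ ⊎ InS G (ratio c v)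
  ratio-critical c v with deg[_] G v ℕ.≤? 2 ℕ.* nC G c v
  ... | yes d≤2a = inj₂ (v , nC G c v , d≤2a , length-filter (T? ∘ (isC ∘ c)) (N[_] G v) , refl)
  ... | no  d≰2a = inj₁ (frac-≤-½ _ _ (ℕP.<⇒≤ (ℕP.≰⇒> d≰2a)))

  threshold-agree : ∀ {w w'} → SameWinPart G w w' → ∀ c v →
                    (ratio c v ℚ.≤ᵇ w) ≡ (ratio c v ℚ.≤ᵇ w')
  threshold-agree (lo , hi , part , (lo≤w , w<hi) , (lo≤w' , w'<hi)) c v =
    ≤ᵇ-outside outside lo≤w w<hi lo≤w' w'<hi
    where
    outside : ratio c v ℚ.≤ lo ⊎ hi ℚ.≤ ratio c v
    outside with ratio-critical c v
    ... | inj₁ ≤½   = inj₁ (ℚP.≤-trans ≤½ (winPart-½ part))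
    ... | inj₂ InS-r = winPart-avoids part InS-r

  power-agree : ∀ {w w'} → SameWinPart G w w' → ∀ c → power G w c ≗ power G w' c
  power-agree sw c v with c v | threshold-agree sw c v
  ... | C | same = cong (λ b → if b then _ else _) same
  ... | D | same = cong (λ b → if b then _ else _) same

  power-cong : ∀ w {c c'} → c ≗ c' → power G w c ≗ power G w c'
  power-cong w {c} {c'} c≗c' v
    with c v | c' v | c≗c' v | countC | countD
    where
    countC : nC G c v ≡ nC G c' v
    countC = cong length (filterᵇ-cong (cong isC ∘ c≗c') (N[_] G v))
    countD : nD G c v ≡ nD G c' v
    countD = cong length (filterᵇ-cong (cong isD ∘ c≗c') (N[_] G v))
  ... | C | .C | refl | eqC | _   rewrite eqC = refl
  ... | D | .D | refl | eqC | eqD rewrite eqC | eqD = refl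

  -- By definition  step G w c  is
  -- stepBy (power G w c) c.
  maxPower : (Fin n → ℚ) → Fin n → ℚ
  maxPower P v = foldr ℚ._⊔_ ℚ.0ℚ (map P (N[_] G v))

  winners : (Fin n → ℚ) → Fin n → List (Fin n)
  winners P v = filterᵇ (λ u → does (P u ℚP.≟ maxPower P v)) (N[_] G v)

  imitate : Config n → List (Fin n) → Strategy → Strategy
  imitate c ws own =
    if allᵇ (isC ∘ c) ws then C else if allᵇ (isD ∘ c) ws then D else own

  stepBy : (Fin n → ℚ) → Config n → Config n
  stepBy P c v = imitate c (winners P v) (c v)

  winners-cong : ∀ {P P'} → P ≗ P' → winners P ≗ winners P'
  winners-cong {P} {P'} P≗P' v = filterᵇ-cong sameTest (N[_] G v)
    where
    sameMax : maxPower P v ≡ maxPower P' v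
    sameMax = cong (foldr ℚ._⊔_ ℚ.0ℚ) (map-cong P≗P' (N[_] G v))
    sameTest : ∀ u → does (P u ℚP.≟ maxPower P v) ≡ does (P' u ℚP.≟ maxPower P' v)
    sameTest u = cong₂ (λ x m → does (x ℚP.≟ m)) (P≗P' u) sameMax

  imitate-cong : ∀ {c c'} → c ≗ c' → ∀ ws own → imitate c ws own ≡ imitate c' ws own
  imitate-cong c≗c' ws own =
    cong₂ (λ allC allD → if allC then C else if allD then D else own)
          (allᵇ-cong (cong isC ∘ c≗c') ws) (allᵇ-cong (cong isD ∘ c≗c') ws)

  stepBy-cong : ∀ {P P' c c'} → P ≗ P' → c ≗ c' → stepBy P c ≗ stepBy P' c'
  stepBy-cong {P} {P'} {c} {c'} P≗P' c≗c' v = begin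
    imitate c  (winners P  v) (c v)  ≡⟨ cong₂ (imitate c) (winners-cong P≗P' v) (c≗c' v) ⟩
    imitate c  (winners P' v) (c' v) ≡⟨ imitate-cong c≗c' (winners P' v) (c' v) ⟩
    imitate c' (winners P' v) (c' v) ∎
    where open ≡-Reasoning

  run-agree : ∀ {w w'} → SameWinPart G w w' → ∀ C₀ t → run G w C₀ t ≗ run G w' C₀ t
  run-agree sw C₀ ℕ.zero    v = refl
  run-agree {w} {w'} sw C₀ (ℕ.suc t) = stepBy-cong samePower (run-agree sw C₀ t)
    where
    samePower : power G w (run G w C₀ t) ≗ power G w' (run G w' C₀ t)
    samePower u = trans (power-agree sw (run G w C₀ t) u)
                        (power-cong w' (run-agree sw C₀ t) u)

mainTheorem5 : {n : ℕ} (G : Graph n) (w w' : ℚ) → SameWinPart G w w' →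
               (C₀ : Config n) → (t : ℕ) → 0 < t → (v : Fin n) →
               run G w C₀ t v ≡ run G w' C₀ t v
mainTheorem5 G w w' sw C₀ t _ = run-agree G sw C₀ t
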